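{- Let $\mathbb{X}$ be a nondegenerate gene of length $f\ge 2$. Then $\mathcal{W}(\mathbb{X})$ is not empty if and only if $\mathbb{X}$ is viable.
   Context: Genes. A gene of length $f$ is a $2f$-periodic sequence $\mathbb{X}=(X_i)_{i\in\mathbb{Z}}$ with values in the four-element set of symbols $\{\mathbf{A},\mathbf{B},\mathbf{AB},\mathbf{0}\}$ such that: (i) if $X_i=\mathbf{AB}$ then $X_{i+1}=\mathbf{0}$; (ii) if $X_i=\mathbf{0}$ then $X_{i-1}\in\{\mathbf{AB},\mathbf{0}\}$; (iii) there exists $i$ with $X_i=\mathbf{0}$ or $X_i\neq X_{i+f}$. The gene is nondegenerate if some $X_i$ equals $\mathbf{0}$. It is viable if there is no $i$ with $X_i=X_{i+f}=\mathbf{0}$. The "column" $i\in\mathbb{Z}/f\mathbb{Z}$ of $\mathbb{X}$ is the pair $(X_i,X_{i+f})$. Fragments. A fragment of length $\ell\ge1$ is a tuple $\underline F=(F_0,\dots,F_{\ell-1})$ of pairs $F_i=(F_i^\uparrow,F_i^\downarrow)\in\{\mathbf{A},\mathbf{B},\mathbf{AB},\mathbf{0}\}^2$ such that: exactly one of $F_0^\uparrow,F_0^\downarrow$ equals $\mathbf{0}$; for $i>0$, $F_i^\uparrow\ne\mathbf 0$ and $F_i^\downarrow\neq\mathbf 0$; for $i<\ell-1$, $F_i^\uparrow\ne\mathbf{AB}$ and $F_i^\downarrow\ne\mathbf{AB}$; if $\ell>1$, exactly one of $F_{\ell-1}^\uparrow,F_{\ell-1}^\downarrow$ equals $\mathbf{AB}$.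 Fragmentary weights. Let $\sim$ be the equivalence relation on $\{\mathbf{A},\mathbf{B},\mathbf{AB},\mathbf{0}\}$ with classes $\{\mathbf{A},\mathbf{AB}\}$ and $\{\mathbf{B},\mathbf{0}\}$. For a set $W$ of tuples and $c\in\{0,1\}$, $W\times\{c\}$ denotes the set of tuples obtained by appending $c$. For a fragment $\underline F$ of length $\ell$ define subsets $W_i^{(b,b)},W_i^{(a,b)},W_i^{(b,a)}\subset\{0,1\}^{i+1}$ ($0\le i\le \ell-1$) by: $W_0^{(b,b)}=\emptyset$ if $\ell=1$ and ($F_0^\uparrow\in\{\mathbf A,\mathbf B\}$ or $F_0^\downarrow\in\{\mathbf A,\mathbf B\}$), and $W_0^{(b,b)}=\{(1)\}$ otherwise; $W_0^{(a,b)}=\emptyset$ if $F_0^\downarrow=\mathbf 0$ and $\{(0)\}$ otherwise; $W_0^{(b,a)}=\emptyset$ if $F_0^\uparrow=\mathbf 0$ and $\{(0)\}$ otherwise; and for $1\le i\le\ell-1$: $W_i^{(b,b)}=(W_{i-1}^{(a,b)}\cup W_{i-1}^{(b,a)})\times\{1\}$ if $F_{i-1}^\uparrow\sim F_{i-1}^\downarrow$, and $W_{i-1}^{(b,b)}\times\{1\}$ otherwise; $W_i^{(a,b)}=W_{i-1}^{(a,b)}\times\{0\}$ if $F_i^\uparrow\sim F_{i-1}^\uparrow$, and $(W_{i-1}^{(b,a)}\cup W_{i-1}^{(b,b)})\times\{0\}$ otherwise; $W_i^{(b,a)}=W_{i-1}^{(b,a)}\times\{0\}$ if $F_i^\downarrow\sim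 F_{i-1}^\downarrow$, and $(W_{i-1}^{(a,b)}\cup W_{i-1}^{(b,b)})\times\{0\}$ otherwise. Then $\mathcal W(\underline F)=W_{\ell-1}^{(b,b)}\cup W_{\ell-1}^{(a,b)}$ if $F_{\ell-1}^\downarrow=\mathbf{AB}$; $=W_{\ell-1}^{(b,b)}\cup W_{\ell-1}^{(b,a)}$ if $F_{\ell-1}^\uparrow=\mathbf{AB}$; $=W_0^{(b,b)}\cup W_0^{(a,b)}\cup W_0^{(b,a)}$ otherwise. Combinatorial weights of a nondegenerate gene. A combinatorial weight is an $f$-periodic sequence $(w_i)_{i\in\mathbb Z}$ with values in $\{0,1\}$. If $\mathbb X$ is not viable, $\mathcal W(\mathbb X)=\emptyset$. If $\mathbb X$ is nondegenerate and viable, let $I\subset\mathbb Z/f\mathbb Z$ be the set of columns $j$ with $X_j=\mathbf 0$ or $X_{j+f}=\mathbf 0$; for $j\in I$ let $\ell_j\in\{1,\dots,f\}$ be the distance to the next element of $I$ (cyclically; $\ell_j=f$ if $|I|=1$), and let $\underline F^{(j)}=((X_{j+k},X_{j+k+f}))_{0\le k<\ell_j}$ be the fragment starting at $j$ (the gene is cut before each column containing $\mathbf 0$). Then $\mathcal W(\mathbb X)$ is the set of combinatorial weights $w$ such that $(w_j,\dots,w_{j+\ell_j-1})\in\mathcal W(\underline F^{(j)})$ for every $j\in I$. -}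

module Defs where

open import Data.Nat using (ℕ; zero; suc; _+_; _*_; _∸_; _≤_; _<_)
open import Data.Bool using (Bool; true; false; if_then_else_)
open import Data.List using (List; []; _∷_; _++_; [_]; map; upTo)
open import Data.Product using (Σ; ∃; _×_; _,_; proj₁; proj₂)
open import Data.Sum using (_⊎_)
open import Relation.Binary.PropositionalEquality using (_≡_)
open import Relation.Nullary using (¬_)
open import Data.List.Membership.Propositional using (_∈_)

data Sym : Set where
  𝐀 𝐁 𝐀𝐁 𝟎 : Sym

-- Genes.  A 2f-periodic sequence indexed by ℤ is represented by its
-- restriction to ℕ together with 2f-periodicity (this determines it).

record Gene (f : ℕ) : Set where
  field
    X        : ℕ → Sym
    periodic : ∀ i → X (i + 2 * f) ≡ X i
    condAB   : ∀ i → X i ≡ 𝐀𝐁 → X (suc i) ≡ 𝟎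
    cond0    : ∀ i → X (suc i) ≡ 𝟎 → (X i ≡ 𝐀𝐁 ⊎ X i ≡ 𝟎)
    cond3    : ∃ λ i → (X i ≡ 𝟎 ⊎ ¬ (X i ≡ X (i + f)))
open Gene public

Nondegenerate : ∀ {f} → Gene f → Set
Nondegenerate G = ∃ λ i → X G i ≡ 𝟎

Viable : ∀ {f} → Gene f → Set
Viable {f} G = ¬ (∃ λ i → (X G i ≡ 𝟎 × X G (i + f) ≡ 𝟎))

-- Fragmentary weights.  Tuples in {0,1}^n are lists of Booleans
-- (true = 1, false = 0); finite sets of tuples are lists of tuples,
-- membership is _∈_.  W × {c} appends c to every tuple.

Tuples : Set
Tuples = List (List Bool)

_×ₛ_ : Tuples → Bool → Tuples
W ×ₛ c = map (λ t → t ++ [ c ]) W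

classA : Sym → Bool
classA 𝐀  = true
classA 𝐀𝐁 = true
classA 𝐁  = false
classA 𝟎  = false

_∼ᵇ_ : Sym → Sym → Bool
x ∼ᵇ y with classA x | classA y
... | true  | true  = true
... | false | false = true
... | _     | _     = false

isAorB : Sym → Bool
isAorB 𝐀 = true
isAorB 𝐁 = true
isAorB _ = false

is0 : Sym → Bool
is0 𝟎 = true
is0 _ = false

isAB : Sym → Bool
isAB 𝐀𝐁 = true
isAB _  = false

isOne : ℕ → Bool
isOne 1 = true
isOne _ = false

_∨_ : Bool → Bool → Bool
true ∨ _ = true
false ∨ b = b

-- A fragment of length ℓ is given by F : ℕ → Sym × Sym (F i = (F_i↑ , F_i↓)),
-- only the values F 0 … F (ℓ-1) being relevant.
-- Wtrip F ℓ i = (W_i^(b,b) , W_i^(a,b) , W_i^(b,a)).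
Wtrip : (ℕ → Sym × Sym) → ℕ → ℕ → Tuples × Tuples × Tuples
Wtrip F ℓ zero =
  ( (if isOne ℓ ∧' (isAorB (proj₁ (F 0)) ∨ isAorB (proj₂ (F 0))) then [] else [ [ true ] ])
  , (if is0 (proj₂ (F 0)) then [] else [ [ false ] ])
  , (if is0 (proj₁ (F 0)) then [] else [ [ false ] ]) )
  where
  _∧'_ : Bool → Bool → Bool
  true ∧' b = b
  false ∧' _ = false
Wtrip F ℓ (suc i) with Wtrip F ℓ i
... | (bb , ab , ba) =
  ( (if proj₁ (F i) ∼ᵇ proj₂ (F i) then (ab ++ ba) ×ₛ true else bb ×ₛ true)
  , (if proj₁ (F (suc i)) ∼ᵇ proj₁ (F i) then ab ×ₛ false else (ba ++ bb) ×ₛ false)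
  , (if proj₂ (F (suc i)) ∼ᵇ proj₂ (F i) then ba ×ₛ false else (ab ++ bb) ×ₛ false) )

Wbb Wab Wba : (ℕ → Sym × Sym) → ℕ → ℕ → Tuples
Wbb F ℓ i = proj₁ (Wtrip F ℓ i)
Wab F ℓ i = proj₁ (proj₂ (Wtrip F ℓ i))
Wba F ℓ i = proj₂ (proj₂ (Wtrip F ℓ i))

fragW : (ℕ → Sym × Sym) → ℕ → Tuples
fragW F ℓ =
  if isAB (proj₂ (F (ℓ ∸ 1))) then Wbb F ℓ (ℓ ∸ 1) ++ Wab F ℓ (ℓ ∸ 1)
  else if isAB (proj₁ (F (ℓ ∸ 1))) then Wbb F ℓ (ℓ ∸ 1) ++ Wba F ℓ (ℓ ∸ 1)
  else Wbb F ℓ 0 ++ Wab F ℓ 0 ++ Wba F ℓ 0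

CombWeight : ℕ → Set
CombWeight f = Σ (ℕ → Bool) λ w → ∀ i → w (i + f) ≡ w i

-- column c (taken mod f) lies in I
InI : ∀ {f} → Gene f → ℕ → Set
InI {f} G c = X G c ≡ 𝟎 ⊎ X G (c + f) ≡ 𝟎

IsGap : ∀ {f} → Gene f → ℕ → ℕ → Set
IsGap {f} G j ℓ =
  1 ≤ ℓ × ℓ ≤ f × InI G (j + ℓ) × (∀ d → 1 ≤ d → d < ℓ → ¬ InI G (j + d))

fragAt : ∀ {f} → Gene f → ℕ → ℕ → Sym × Sym
fragAt {f} G j k = (X G (j + k) , X G (j + k + f))

window : (ℕ → Bool) → ℕ → ℕ → List Bool
window w j ℓ = map (λ k → w (j + k)) (upTo ℓ)

InW : ∀ {f} → Gene f → CombWeight f → Set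
InW {f} G (w , _) =
  Viable G ×
  (∀ j → j < f → InI G j → ∀ ℓ → IsGap G j ℓ → window w j ℓ ∈ fragW (fragAt G j) ℓ)

-- A weight in 𝒲(𝕏) records viability, so only the converse needs work.  For a
-- fragment with exactly one 𝟎 in its first column, the recursion defining 𝒲
-- keeps W^(b,b) and one of W^(a,b), W^(b,a) nonempty, all tuples have the
-- fragment's length, and swapping the two rows can only shrink 𝒲.  In a viable
-- gene every fragment has this shape.  Choose one tuple of 𝒲 per fragment,
-- always computed in the orientation with 𝟎 in the top row; shifting the gene by
-- f swaps the rows, so the choice is shift invariant, and writing the chosen
-- tuples side by side gives an f-periodic combinatorial weight in 𝒲(𝕏).

module Submission where

open import Defs
open import Data.Bool using (Bool; true; false; if_then_else_)
open import Data.Empty using (⊥-elim)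
open import Data.List using (List; []; _∷_; _++_; [_]; map; length; applyUpTo; upTo)
open import Data.List.Membership.Propositional using (_∈_)
open import Data.List.Membership.Propositional.Properties using (∈-map⁺)
open import Data.List.Properties using (length-++; map-upTo)
open import Data.List.Relation.Binary.Permutation.Propositional.Properties using (++-comm)
open import Data.List.Relation.Binary.Subset.Propositional using (_⊆_)
open import Data.List.Relation.Binary.Subset.Propositional.Properties
  using (⊆-trans; ⊆-reflexive-↭; map⁺; ++⁺; xs⊆xs++ys; xs⊆ys++xs)
open import Data.List.Relation.Unary.All as All using (All; []; _∷_)
import Data.List.Relation.Unary.All.Properties as All
open import Data.List.Relation.Unary.Any using (here)
open import Data.Nat using (ℕ; zero; suc; _+_; _∸_; _≤_; _<_; _<?_; z≤n; s≤s; z<s; s<s; s<s⁻¹)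
open import Data.Nat.Properties
  using (+-comm; +-assoc; +-identityʳ; +-suc; +-∸-comm; +-∸-assoc; m+n∸n≡m; m∸n≤m; m<n⇒0<n∸m;
         ≤-trans; ≤-refl; <⇒≤; ≤-<-trans; m≤n+m; +-commutativeSemigroup)
open import Algebra.Properties.CommutativeSemigroup +-commutativeSemigroup using (xy∙z≈xz∙y)
open import Data.Product using (∃; _×_; _,_; proj₁; proj₂; swap)
open import Data.Sum using (_⊎_; inj₁; inj₂)
open import Function using (_∘_; id)
open import Function.Bundles using (_⇔_; mk⇔)
open import Relation.Nullary using (¬_; yes; no)
open import Relation.Binary.PropositionalEquality
  using (_≡_; _≗_; refl; sym; trans; cong; cong₂; subst; module ≡-Reasoning)

firstTrue : (ℕ → Bool) → ℕ → ℕ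
firstTrue p zero    = zero
firstTrue p (suc n) = if p zero then zero else suc (firstTrue (p ∘ suc) n)

firstTrue-≤ : ∀ p n → firstTrue p n ≤ n
firstTrue-≤ p zero = z≤n
firstTrue-≤ p (suc n) with p zero
... | true  = z≤n
... | false = s≤s (firstTrue-≤ (p ∘ suc) n)

firstTrue-true : ∀ p n → firstTrue p n < n → p (firstTrue p n) ≡ true
firstTrue-true p (suc n) lt with p zero in p0
... | true  = p0
... | false = firstTrue-true (p ∘ suc) n (s<s⁻¹ lt)

firstTrue-exact : ∀ p n d → d < n → p d ≡ true → (∀ e → e < d → p e ≡ false) →
                  firstTrue p n ≡ d
firstTrue-exact p (suc n) zero    _         pd _ rewrite pd = refl
firstTrue-exact p (suc n) (suc d) (s<s d<n) pd before rewrite before 0 z<s =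
  cong suc (firstTrue-exact (p ∘ suc) n d d<n pd (λ e e<d → before (suc e) (s<s e<d)))

firstTrue-cong : ∀ p q n → (∀ d → d < n → p d ≡ q d) → firstTrue p n ≡ firstTrue q n
firstTrue-cong p q zero    _  = refl
firstTrue-cong p q (suc n) eq rewrite eq 0 z<s
  | firstTrue-cong (p ∘ suc) (q ∘ suc) n (λ d d<n → eq (suc d) (s<s d<n)) = refl

nth : List Bool → ℕ → Bool
nth []       _       = false
nth (b ∷ bs) zero    = b
nth (b ∷ bs) (suc k) = nth bs k

applyUpTo-nth : ∀ bs → applyUpTo (nth bs) (length bs) ≡ bs
applyUpTo-nth []       = refl
applyUpTo-nth (b ∷ bs) = cong (b ∷_) (applyUpTo-nth bs)

applyUpTo-cong : ∀ {A : Set} (g h : ℕ → A) n → (∀ k → k < n → g k ≡ h k) →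
                 applyUpTo g n ≡ applyUpTo h n
applyUpTo-cong g h zero    _  = refl
applyUpTo-cong g h (suc n) eq =
  cong₂ _∷_ (eq 0 z<s) (applyUpTo-cong (g ∘ suc) (h ∘ suc) n (λ k k<n → eq (suc k) (s<s k<n)))

if-elim : ∀ {A : Set} {P : A → Set} b {x y} → P x → P y → P (if b then x else y)
if-elim true  px _  = px
if-elim false _  py = py

Nonempty : Tuples → Set
Nonempty W = ∃ (_∈ W)

nonempty-⊆ : ∀ {V W} → V ⊆ W → Nonempty V → Nonempty W
nonempty-⊆ V⊆W (t , t∈V) = t , V⊆W t∈V

choose : Tuples → List Bool
choose []      = []
choose (t ∷ _) = t

choose-∈ : ∀ {W} → Nonempty W → choose W ∈ W
choose-∈ {_ ∷ _} _ = here refl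

×ₛ-⊆ : ∀ {V W} c → V ⊆ W → V ×ₛ c ⊆ W ×ₛ c
×ₛ-⊆ c = map⁺ (_++ [ c ])

×ₛ-nonempty : ∀ {W} c → Nonempty W → Nonempty (W ×ₛ c)
×ₛ-nonempty c (t , t∈W) = t ++ [ c ] , ∈-map⁺ (_++ [ c ]) t∈W

++-⊆-flip : ∀ {V W V′ W′ : Tuples} → V ⊆ W′ → W ⊆ V′ → V ++ W ⊆ V′ ++ W′
++-⊆-flip {V} {W} V⊆W′ W⊆V′ = ⊆-trans (⊆-reflexive-↭ (++-comm V W)) (++⁺ W⊆V′ V⊆W′)

if-⊆ : ∀ b {V W V′ W′ : Tuples} → V ⊆ V′ → W ⊆ W′ → (if b then V else W) ⊆ (if b then V′ else W′)
if-⊆ true  V⊆V′ _    = V⊆V′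
if-⊆ false _    W⊆W′ = W⊆W′

OfLength : ℕ → Tuples → Set
OfLength n = All (λ t → length t ≡ n)

×ₛ-ofLength : ∀ {n W} c → OfLength n W → OfLength (suc n) (W ×ₛ c)
×ₛ-ofLength {n} c ts = All.map⁺ {f = _++ [ c ]} (All.map (λ {t} → appended t) ts)
  where
  appended : ∀ t → length t ≡ n → length (t ++ [ c ]) ≡ suc n
  appended t len≡n = trans (length-++ t) (trans (cong (_+ 1) len≡n) (+-comm n 1))

-- Fragmentary weights

∨-comm : ∀ a b → (a ∨ b) ≡ (b ∨ a)
∨-comm true  true  = refl
∨-comm true  false = refl
∨-comm false true  = refl
∨-comm false false = refl

∼ᵇ-sym : ∀ x y → (x ∼ᵇ y) ≡ (y ∼ᵇ x)
∼ᵇ-sym x y with classA x | classA y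
... | true  | true  = refl
... | true  | false = refl
... | false | true  = refl
... | false | false = refl

Wtrip-swap : ∀ F ℓ i → Wbb (swap ∘ F) ℓ i ⊆ Wbb F ℓ i
                     × Wab (swap ∘ F) ℓ i ⊆ Wba F ℓ i
                     × Wba (swap ∘ F) ℓ i ⊆ Wab F ℓ i
Wtrip-swap F ℓ zero = Wbb₀ , id , id
  where
  Wbb₀ : Wbb (swap ∘ F) ℓ 0 ⊆ Wbb F ℓ 0
  Wbb₀ rewrite ∨-comm (isAorB (proj₂ (F 0))) (isAorB (proj₁ (F 0))) = id
Wtrip-swap F ℓ (suc i) with Wtrip-swap F ℓ i
... | bb , ab , ba = bb′ , if-⊆ (proj₂ (F (suc i)) ∼ᵇ proj₂ (F i)) (×ₛ-⊆ false ab) (×ₛ-⊆ false (++⁺ ba bb))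
                         , if-⊆ (proj₁ (F (suc i)) ∼ᵇ proj₁ (F i)) (×ₛ-⊆ false ba) (×ₛ-⊆ false (++⁺ ab bb))
  where
  bb′ : Wbb (swap ∘ F) ℓ (suc i) ⊆ Wbb F ℓ (suc i)
  bb′ rewrite ∼ᵇ-sym (proj₂ (F i)) (proj₁ (F i)) =
    if-⊆ (proj₁ (F i) ∼ᵇ proj₂ (F i)) (×ₛ-⊆ true (++-⊆-flip ab ba)) (×ₛ-⊆ true bb)

isAB-true : ∀ {x} → isAB x ≡ true → x ≡ 𝐀𝐁
isAB-true {𝐀𝐁} _ = refl

is0-true : ∀ {x} → is0 x ≡ true → x ≡ 𝟎
is0-true {𝟎} _ = refl

fragW-swap : ∀ F ℓ → ¬ (proj₁ (F (ℓ ∸ 1)) ≡ 𝐀𝐁 × proj₂ (F (ℓ ∸ 1)) ≡ 𝐀𝐁) →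
             fragW (swap ∘ F) ℓ ⊆ fragW F ℓ
fragW-swap F ℓ notBothAB with Wtrip-swap F ℓ (ℓ ∸ 1) | Wtrip-swap F ℓ 0
  | isAB (proj₁ (F (ℓ ∸ 1))) in up | isAB (proj₂ (F (ℓ ∸ 1))) in down
... | _            | _               | true  | true  = ⊥-elim (notBothAB (isAB-true up , isAB-true down))
... | bb , ab , _  | _               | true  | false = ++⁺ bb ab
... | bb , _ , ba  | _               | false | true  = ++⁺ bb ba
... | _            | bb₀ , ab₀ , ba₀ | false | false = ++⁺ bb₀ (++-⊆-flip ab₀ ba₀)

Wtrip-nonempty : ∀ F m → ¬ (proj₁ (F 0) ≡ 𝟎 × proj₂ (F 0) ≡ 𝟎) → ∀ i →
                 Nonempty (Wbb F (2 + m) i) × (Nonempty (Wab F (2 + m) i) ⊎ Nonempty (Wba F (2 + m) i))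
Wtrip-nonempty F m notBoth0 zero = (_ , here refl) , start
  where
  start : Nonempty (Wab F (2 + m) 0) ⊎ Nonempty (Wba F (2 + m) 0)
  start with is0 (proj₂ (F 0)) in e↓ | is0 (proj₁ (F 0)) in e↑
  ... | false | _     = inj₁ (_ , here refl)
  ... | true  | false = inj₂ (_ , here refl)
  ... | true  | true  = ⊥-elim (notBoth0 (is0-true e↑ , is0-true e↓))
Wtrip-nonempty F m notBoth0 (suc i) with Wtrip-nonempty F m notBoth0 i
... | bb , inj₁ ab =
  if-elim {P = Nonempty} (proj₁ (F i) ∼ᵇ proj₂ (F i))
    (×ₛ-nonempty true (nonempty-⊆ (xs⊆xs++ys _ _) ab)) (×ₛ-nonempty true bb)
  , inj₁ (if-elim {P = Nonempty} (proj₁ (F (suc i)) ∼ᵇ proj₁ (F i))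
    (×ₛ-nonempty false ab) (×ₛ-nonempty false (nonempty-⊆ (xs⊆ys++xs _ _) bb)))
... | bb , inj₂ ba =
  if-elim {P = Nonempty} (proj₁ (F i) ∼ᵇ proj₂ (F i))
    (×ₛ-nonempty true (nonempty-⊆ (xs⊆ys++xs _ _) ba)) (×ₛ-nonempty true bb)
  , inj₂ (if-elim {P = Nonempty} (proj₂ (F (suc i)) ∼ᵇ proj₂ (F i))
    (×ₛ-nonempty false ba) (×ₛ-nonempty false (nonempty-⊆ (xs⊆ys++xs _ _) bb)))

fragW₁-nonempty : ∀ a b → ¬ (a ≡ 𝟎 × b ≡ 𝟎) → Nonempty (fragW (λ _ → a , b) 1)
fragW₁-nonempty 𝐀  𝐀  _ = _ , here refl
fragW₁-nonempty 𝐀  𝐁  _ = _ , here refl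
fragW₁-nonempty 𝐀  𝐀𝐁 _ = _ , here refl
fragW₁-nonempty 𝐀  𝟎  _ = _ , here refl
fragW₁-nonempty 𝐁  𝐀  _ = _ , here refl
fragW₁-nonempty 𝐁  𝐁  _ = _ , here refl
fragW₁-nonempty 𝐁  𝐀𝐁 _ = _ , here refl
fragW₁-nonempty 𝐁  𝟎  _ = _ , here refl
fragW₁-nonempty 𝐀𝐁 𝐀  _ = _ , here refl
fragW₁-nonempty 𝐀𝐁 𝐁  _ = _ , here refl
fragW₁-nonempty 𝐀𝐁 𝐀𝐁 _ = _ , here refl
fragW₁-nonempty 𝐀𝐁 𝟎  _ = _ , here refl
fragW₁-nonempty 𝟎  𝐀  _ = _ , here refl
fragW₁-nonempty 𝟎  𝐁  _ = _ , here refl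
fragW₁-nonempty 𝟎  𝐀𝐁 _ = _ , here refl
fragW₁-nonempty 𝟎  𝟎  no00 = ⊥-elim (no00 (refl , refl))

fragW-nonempty : ∀ F ℓ → 1 ≤ ℓ → ¬ (proj₁ (F 0) ≡ 𝟎 × proj₂ (F 0) ≡ 𝟎) → Nonempty (fragW F ℓ)
fragW-nonempty F (suc zero) _ notBoth0 = fragW₁-nonempty (proj₁ (F 0)) (proj₂ (F 0)) notBoth0
fragW-nonempty F (suc (suc m)) _ notBoth0 =
  if-elim {P = Nonempty} (isAB (proj₂ (F (suc m)))) (nonempty-⊆ (xs⊆xs++ys _ _) bb)
    (if-elim {P = Nonempty} (isAB (proj₁ (F (suc m)))) (nonempty-⊆ (xs⊆xs++ys _ _) bb)
      (nonempty-⊆ (xs⊆xs++ys _ _) (proj₁ (Wtrip-nonempty F m notBoth0 0))))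
  where
  bb : Nonempty (Wbb F (2 + m) (suc m))
  bb = proj₁ (Wtrip-nonempty F m notBoth0 (suc m))

Wtrip-ofLength : ∀ F ℓ i → OfLength (suc i) (Wbb F ℓ i)
                         × OfLength (suc i) (Wab F ℓ i)
                         × OfLength (suc i) (Wba F ℓ i)
Wtrip-ofLength F ℓ zero = atMostSingleton , atMostSingleton , atMostSingleton
  where
  atMostSingleton : ∀ {b c} → OfLength 1 (if b then [] else [ [ c ] ])
  atMostSingleton {b} = if-elim {P = OfLength 1} b [] (refl ∷ [])
Wtrip-ofLength F ℓ (suc i) with Wtrip-ofLength F ℓ i
... | bb , ab , ba =
    if-elim {P = OfLength (2 + i)} (proj₁ (F i) ∼ᵇ proj₂ (F i)) (×ₛ-ofLength true (All.++⁺ ab ba)) (×ₛ-ofLength true bb)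
  , if-elim {P = OfLength (2 + i)} (proj₁ (F (suc i)) ∼ᵇ proj₁ (F i)) (×ₛ-ofLength false ab) (×ₛ-ofLength false (All.++⁺ ba bb))
  , if-elim {P = OfLength (2 + i)} (proj₂ (F (suc i)) ∼ᵇ proj₂ (F i)) (×ₛ-ofLength false ba) (×ₛ-ofLength false (All.++⁺ ab bb))

fragW-ofLength : ∀ F ℓ → 1 ≤ ℓ → (ℓ ≡ 1 ⊎ proj₂ (F (ℓ ∸ 1)) ≡ 𝐀𝐁 ⊎ proj₁ (F (ℓ ∸ 1)) ≡ 𝐀𝐁) →
                 OfLength ℓ (fragW F ℓ)
fragW-ofLength F (suc m) _ ends with Wtrip-ofLength F (suc m) m
  | isAB (proj₂ (F m)) in down | isAB (proj₁ (F m)) in up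
... | bb , ab , _ | true  | _    = All.++⁺ bb ab
... | bb , _ , ba | false | true = All.++⁺ bb ba
... | _           | false | false with ends
...   | inj₁ refl = let bb , ab , ba = Wtrip-ofLength F 1 0 in All.++⁺ bb (All.++⁺ ab ba)
...   | inj₂ (inj₁ ↓AB) with () ← trans (sym (cong isAB ↓AB)) down
...   | inj₂ (inj₂ ↑AB) with () ← trans (sym (cong isAB ↑AB)) up

module _ (F F′ : ℕ → Sym × Sym) (F≗F′ : F ≗ F′) where

  Wtrip-cong : ∀ ℓ i → Wtrip F ℓ i ≡ Wtrip F′ ℓ i
  Wtrip-cong zero          zero rewrite F≗F′ 0 = refl
  Wtrip-cong (suc zero)    zero rewrite F≗F′ 0 = refl
  Wtrip-cong (suc (suc _)) zero rewrite F≗F′ 0 = refl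
  Wtrip-cong ℓ (suc i) rewrite F≗F′ i | F≗F′ (suc i) | Wtrip-cong ℓ i = refl

  fragW-cong : ∀ ℓ → fragW F ℓ ≡ fragW F′ ℓ
  fragW-cong ℓ = cong₂ assemble (F≗F′ (ℓ ∸ 1)) (cong₂ _,_ (Wtrip-cong ℓ (ℓ ∸ 1)) (Wtrip-cong ℓ 0))
    where
    assemble : Sym × Sym → (Tuples × Tuples × Tuples) × (Tuples × Tuples × Tuples) → Tuples
    assemble last ((bb , ab , ba) , (bb₀ , ab₀ , ba₀)) =
      if isAB (proj₂ last) then bb ++ ab else if isAB (proj₁ last) then bb ++ ba else bb₀ ++ ab₀ ++ ba₀

record FragmentEnds (F : ℕ → Sym × Sym) (ℓ : ℕ) : Set where
  field
    nonzeroLength : 1 ≤ ℓ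
    someZero      : proj₁ (F 0) ≡ 𝟎 ⊎ proj₂ (F 0) ≡ 𝟎
    notBothZero   : ¬ (proj₁ (F 0) ≡ 𝟎 × proj₂ (F 0) ≡ 𝟎)
    notBothAB     : ¬ (proj₁ (F (ℓ ∸ 1)) ≡ 𝐀𝐁 × proj₂ (F (ℓ ∸ 1)) ≡ 𝐀𝐁)
    endsWithAB    : ℓ ≡ 1 ⊎ proj₂ (F (ℓ ∸ 1)) ≡ 𝐀𝐁 ⊎ proj₁ (F (ℓ ∸ 1)) ≡ 𝐀𝐁

canonical : (ℕ → Sym × Sym) → ℕ → List Bool
canonical F ℓ = if is0 (proj₂ (F 0)) then choose (fragW (swap ∘ F) ℓ) else choose (fragW F ℓ)

module _ {F ℓ} (ends : FragmentEnds F ℓ) where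
  open FragmentEnds ends

  canonical-∈ : canonical F ℓ ∈ fragW F ℓ
  canonical-∈ = if-elim {P = _∈ fragW F ℓ} (is0 (proj₂ (F 0)))
    (fragW-swap F ℓ notBothAB
      (choose-∈ (fragW-nonempty (swap ∘ F) ℓ nonzeroLength (notBothZero ∘ swap))))
    (choose-∈ (fragW-nonempty F ℓ nonzeroLength notBothZero))

  canonical-length : length (canonical F ℓ) ≡ ℓ
  canonical-length = All.lookup (fragW-ofLength F ℓ nonzeroLength endsWithAB) canonical-∈

canonical-swap : ∀ F ℓ → proj₁ (F 0) ≡ 𝟎 ⊎ proj₂ (F 0) ≡ 𝟎 → ¬ (proj₁ (F 0) ≡ 𝟎 × proj₂ (F 0) ≡ 𝟎) →
                 canonical (swap ∘ F) ℓ ≡ canonical F ℓ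
canonical-swap F ℓ someZero notBoth0 with is0 (proj₁ (F 0)) in e↑ | is0 (proj₂ (F 0)) in e↓
... | true  | true  = ⊥-elim (notBoth0 (is0-true e↑ , is0-true e↓))
... | true  | false = refl
... | false | true  = refl
... | false | false with someZero
...   | inj₁ ↑0 with () ← trans (sym (cong is0 ↑0)) e↑
...   | inj₂ ↓0 with () ← trans (sym (cong is0 ↓0)) e↓

canonical-cong : ∀ F F′ ℓ → F ≗ F′ → canonical F ℓ ≡ canonical F′ ℓ
canonical-cong F F′ ℓ F≗F′ =
  cong₂ (λ start (V , W) → if is0 (proj₂ start) then choose V else choose W) (F≗F′ 0)
    (cong₂ _,_ (fragW-cong (swap ∘ F) (swap ∘ F′) (cong swap ∘ F≗F′) ℓ) (fragW-cong F F′ F≗F′ ℓ))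

-- Combinatorial weights of a viable gene

module ViableGene {f : ℕ} (G : Gene f) (viable : Viable G) where

  cut? : ℕ → Bool
  cut? c = is0 (X G c) ∨ is0 (X G (c + f))

  cut?-sound : ∀ {c} → cut? c ≡ true → InI G c
  cut?-sound {c} e with is0 (X G c) in top
  ... | true  = inj₁ (is0-true top)
  ... | false = inj₂ (is0-true e)

  cut?-complete : ∀ {c} → InI G c → cut? c ≡ true
  cut?-complete (inj₁ top) rewrite top = refl
  cut?-complete {c} (inj₂ bottom) rewrite bottom with is0 (X G c)
  ... | true  = refl
  ... | false = refl

  cut?-false : ∀ {c} → ¬ InI G c → cut? c ≡ false
  cut?-false {c} noCut with cut? c in e
  ... | true  = ⊥-elim (noCut (cut?-sound e))
  ... | false = refl

  X-+f+f : ∀ c → X G (c + f + f) ≡ X G c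
  X-+f+f c = trans (cong (X G) (trans (+-assoc c f f) (cong (λ n → c + (f + n)) (sym (+-identityʳ f)))))
                   (periodic G c)

  cut?-+f : ∀ c → cut? (c + f) ≡ cut? c
  cut?-+f c rewrite X-+f+f c = ∨-comm (is0 (X G (c + f))) (is0 (X G c))

  fragAt-+f : ∀ c k → fragAt G (c + f) k ≡ swap (fragAt G c k)
  fragAt-+f c k = cong₂ _,_ (cong (X G) (xy∙z≈xz∙y c f k))
                            (trans (cong (λ n → X G (n + f)) (xy∙z≈xz∙y c f k)) (X-+f+f (c + k)))

  -- Distance from c back to the nearest cut within f ∸ 1 columns (f if there is
  -- none), searched from c + f to avoid truncated subtraction.
  back : ℕ → ℕ
  back c = firstTrue (λ d → cut? (c + f ∸ d)) f

  start : ℕ → ℕ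
  start c = c + f ∸ back c

  gap : ℕ → ℕ
  gap c = suc (firstTrue (λ d → cut? (c + suc d)) f)

  canonicalAt : ℕ → List Bool
  canonicalAt c = canonical (fragAt G c) (gap c)

  weight : ℕ → ℕ → Bool
  weight d c with d <? f
  ... | yes _ = nth (canonicalAt c) d
  ... | no  _ = false

  w : ℕ → Bool
  w i = weight (back i) (start i)

  m+f+f∸d≡m+f∸d+f : ∀ i d → d ≤ f → i + f + f ∸ d ≡ i + f ∸ d + f
  m+f+f∸d≡m+f∸d+f i d d≤f = +-∸-comm f (≤-trans d≤f (m≤n+m f i))

  back-+f : ∀ i → back (i + f) ≡ back i
  back-+f i = firstTrue-cong _ _ f λ d d<f →
    trans (cong cut? (m+f+f∸d≡m+f∸d+f i d (<⇒≤ d<f))) (cut?-+f (i + f ∸ d))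

  start-+f : ∀ i → start (i + f) ≡ start i + f
  start-+f i rewrite back-+f i = m+f+f∸d≡m+f∸d+f i (back i) (firstTrue-≤ _ f)

  start-cut : ∀ i → back i < f → InI G (start i)
  start-cut i found = cut?-sound (firstTrue-true _ f found)

  gap-+f : ∀ c → gap (c + f) ≡ gap c
  gap-+f c = cong suc (firstTrue-cong _ _ f λ d _ →
    trans (cong cut? (xy∙z≈xz∙y c f (suc d))) (cut?-+f (c + suc d)))

  canonicalAt-+f : ∀ c → InI G c → canonicalAt (c + f) ≡ canonicalAt c
  canonicalAt-+f c cut = begin
    canonical (fragAt G (c + f)) (gap (c + f)) ≡⟨ cong (canonical (fragAt G (c + f))) (gap-+f c) ⟩
    canonical (fragAt G (c + f)) (gap c)       ≡⟨ canonical-cong _ _ (gap c) (fragAt-+f c) ⟩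
    canonical (swap ∘ fragAt G c) (gap c)      ≡⟨ canonical-swap (fragAt G c) (gap c)
                                                    (subst (InI G) (sym (+-identityʳ c)) cut)
                                                    (λ both0 → viable (c + 0 , both0)) ⟩
    canonicalAt c                              ∎
    where open ≡-Reasoning

  weight-+f : ∀ d c → (d < f → InI G c) → weight d (c + f) ≡ weight d c
  weight-+f d c cut with d <? f
  ... | yes d<f = cong (λ t → nth t d) (canonicalAt-+f c (cut d<f))
  ... | no  _   = refl

  w-+f : ∀ i → w (i + f) ≡ w i
  w-+f i = trans (cong₂ weight (back-+f i) (start-+f i)) (weight-+f (back i) (start i) (start-cut i))

  lastColumn-AB : ∀ n → X G (suc n) ≡ 𝟎 → ¬ X G n ≡ 𝟎 → X G n ≡ 𝐀𝐁
  lastColumn-AB n next0 not0 with cond0 G n next0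
  ... | inj₁ AB = AB
  ... | inj₂ z  = ⊥-elim (not0 z)

  fragment-ends : ∀ {j ℓ} → InI G j → IsGap G j ℓ → FragmentEnds (fragAt G j) ℓ
  fragment-ends {j} {ℓ} cut (1≤ℓ , _ , endCut , noCut) = record
    { nonzeroLength = 1≤ℓ
    ; someZero      = subst (InI G) (sym (+-identityʳ j)) cut
    ; notBothZero   = λ both0 → viable (j + 0 , both0)
    ; notBothAB     = notBothAB ℓ 1≤ℓ
    ; endsWithAB    = endsWithAB ℓ 1≤ℓ endCut noCut
    }
    where
    notBothAB : ∀ ℓ → 1 ≤ ℓ → ¬ (X G (j + (ℓ ∸ 1)) ≡ 𝐀𝐁 × X G (j + (ℓ ∸ 1) + f) ≡ 𝐀𝐁)
    notBothAB (suc m) _ (top , bottom) = viable (suc (j + m) , condAB G _ top , condAB G _ bottom)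

    endsWithAB : ∀ ℓ → 1 ≤ ℓ → InI G (j + ℓ) → (∀ d → 1 ≤ d → d < ℓ → ¬ InI G (j + d)) →
                 ℓ ≡ 1 ⊎ X G (j + (ℓ ∸ 1) + f) ≡ 𝐀𝐁 ⊎ X G (j + (ℓ ∸ 1)) ≡ 𝐀𝐁
    endsWithAB (suc zero)    _ _ _ = inj₁ refl
    endsWithAB (suc (suc m)) _ (inj₁ top0) noCut = inj₂ (inj₂ (lastColumn-AB (j + suc m)
      (subst (λ n → X G n ≡ 𝟎) (+-suc j (suc m)) top0)
      (λ z → noCut (suc m) (s≤s z≤n) ≤-refl (inj₁ z))))
    endsWithAB (suc (suc m)) _ (inj₂ bottom0) noCut = inj₂ (inj₁ (lastColumn-AB (j + suc m + f)
      (subst (λ n → X G (n + f) ≡ 𝟎) (+-suc j (suc m)) bottom0)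
      (λ z → noCut (suc m) (s≤s z≤n) ≤-refl (inj₂ z))))

  m+n+f∸n≡m+f : ∀ j k → j + k + f ∸ k ≡ j + f
  m+n+f∸n≡m+f j k = trans (cong (_∸ k) (xy∙z≈xz∙y j k f)) (m+n∸n≡m (j + f) k)

  back-inGap : ∀ {j ℓ} → InI G j → IsGap G j ℓ → ∀ k → k < ℓ → back (j + k) ≡ k
  back-inGap {j} cut (_ , ℓ≤f , _ , noCut) k k<ℓ =
    firstTrue-exact _ f k (≤-trans k<ℓ ℓ≤f)
      (trans (cong cut? (m+n+f∸n≡m+f j k)) (trans (cut?-+f j) (cut?-complete cut)))
      (λ e e<k → trans (cong cut? (shift e (<⇒≤ e<k))) (trans (cut?-+f (j + (k ∸ e)))
        (cut?-false (noCut (k ∸ e) (m<n⇒0<n∸m e<k) (≤-<-trans (m∸n≤m k e) k<ℓ)))))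
    where
    shift : ∀ e → e ≤ k → j + k + f ∸ e ≡ j + (k ∸ e) + f
    shift e e≤k = trans (+-∸-comm f (≤-trans e≤k (m≤n+m k j))) (cong (_+ f) (+-∸-assoc j e≤k))

  gap-atCut : ∀ {j ℓ} → IsGap G j ℓ → gap j ≡ ℓ
  gap-atCut {j} {suc m} (_ , ℓ≤f , endCut , noCut) = cong suc
    (firstTrue-exact _ f m ℓ≤f (cut?-complete endCut)
      (λ e e<m → cut?-false (noCut (suc e) (s≤s z≤n) (s<s e<m))))

  weight-below : ∀ d c → d < f → weight d c ≡ nth (canonicalAt c) d
  weight-below d c d<f with d <? f
  ... | yes _   = refl
  ... | no  d≮f = ⊥-elim (d≮f d<f)

  w-inGap : ∀ {j ℓ} → InI G j → IsGap G j ℓ → ∀ k → k < ℓ → w (j + k) ≡ nth (canonical (fragAt G j) ℓ) k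
  w-inGap {j} {ℓ} cut gp@(_ , ℓ≤f , _) k k<ℓ = begin
    weight (back (j + k)) (start (j + k)) ≡⟨ cong₂ weight (back-inGap cut gp k k<ℓ) start-inGap ⟩
    weight k (j + f)                      ≡⟨ weight-+f k j (λ _ → cut) ⟩
    weight k j                            ≡⟨ weight-below k j (≤-trans k<ℓ ℓ≤f) ⟩
    nth (canonicalAt j) k                 ≡⟨ cong (λ n → nth (canonical (fragAt G j) n) k) (gap-atCut gp) ⟩
    nth (canonical (fragAt G j) ℓ) k      ∎
    where
    open ≡-Reasoning
    start-inGap : start (j + k) ≡ j + f
    start-inGap rewrite back-inGap cut gp k k<ℓ = m+n+f∸n≡m+f j k

  window-∈ : ∀ {j ℓ} → InI G j → IsGap G j ℓ → window w j ℓ ∈ fragW (fragAt G j) ℓ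
  window-∈ {j} {ℓ} cut gp = subst (_∈ fragW (fragAt G j) ℓ) (sym window≡) (canonical-∈ ends)
    where
    open ≡-Reasoning
    ends : FragmentEnds (fragAt G j) ℓ
    ends = fragment-ends cut gp
    t : List Bool
    t = canonical (fragAt G j) ℓ
    window≡ : window w j ℓ ≡ t
    window≡ = begin
      map (λ k → w (j + k)) (upTo ℓ)   ≡⟨ map-upTo (λ k → w (j + k)) ℓ ⟩
      applyUpTo (λ k → w (j + k)) ℓ   ≡⟨ applyUpTo-cong _ _ ℓ (w-inGap cut gp) ⟩
      applyUpTo (nth t) ℓ             ≡⟨ cong (applyUpTo (nth t)) (sym (canonical-length ends)) ⟩
      applyUpTo (nth t) (length t)    ≡⟨ applyUpTo-nth t ⟩
      t                               ∎

  combinatorialWeight : ∃ (InW G)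
  combinatorialWeight = (w , w-+f) , viable , λ _ _ cut _ gp → window-∈ cut gp

theorem2p2p1 : (f : ℕ) → 2 ≤ f → (G : Gene f) → Nondegenerate G →
    ((∃ λ (w : CombWeight f) → InW G w) ⇔ Viable G)
theorem2p2p1 f _ G _ = mk⇔ (proj₁ ∘ proj₂) (ViableGene.combinatorialWeight G)
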